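{- Let $\langle Q,T\rangle$ be a $(Q_1,Q_P)$-single-sided VASS of dimension $d$. For every formula $\varphi\in L^{sv}_\mu$ and every upward-closed environment $\varepsilon$, the set $[\![\varphi]\!]_\varepsilon\subseteq Q\times\mathbb{N}^d$, evaluated over the configurations of $\langle Q,T\rangle$, is upward-closed.
   Context: A VASS of dimension $d$ is $\langle Q,T\rangle$ with finite $Q$ and finite $T\subseteq Q\times\mathbb{Z}^d\times Q$; configurations are $Q\times\mathbb{N}^d$ and $\langle q,\mathbf{v}\rangle\rightarrow\langle q',\mathbf{v}+\mathbf{z}\rangle$ iff $\langle q,\mathbf{z},q'\rangle\in T$ and $\mathbf{v}+\mathbf{z}\in\mathbb{N}^d$. It is $(Q_1,Q_P)$-single-sided, for a partition $Q=Q_1\uplus Q_P$, if every transition $\langle q,\mathbf{z},q'\rangle\in T$ with $q\in Q_P$ has $\mathbf{z}=\mathbf{0}$. Configurations are ordered by $\langle q,\mathbf{v}\rangle\le\langle q',\mathbf{v}'\rangle$ iff $q=q'$ and $\mathbf{v}\le\mathbf{v}'$ componentwise; a set of configurations is upward-closed if it is closed upward under $\le$. The logic $L^{sv}_\mu$ (for this single-sided VASS) consists of formulas $\varphi::= q\mid X\mid\varphi\wedge\varphi\mid\varphi\vee\varphi\mid\Diamond\varphi\mid Q_P\wedge\Box\varphi\mid\mu X.\varphi\mid\nu X.\varphi$ with $q\in Q$, $X$ from a set of variables, and $Q_P$ abbreviating $\bigvee_{q\in Q_P}q$. An environment $\varepsilon$ maps variables to sets of configurations; it is upward-closed if every $\varepsilon(X)$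 is. Semantics: $[\![q]\!]_\varepsilon=\{q\}\times\mathbb{N}^d$, $[\![X]\!]_\varepsilon=\varepsilon(X)$, $\wedge,\vee$ are intersection and union, $[\![\Diamond\varphi]\!]_\varepsilon=\{c\mid\exists c'.\ c\rightarrow c'\in[\![\varphi]\!]_\varepsilon\}$, $[\![\Box\varphi]\!]_\varepsilon=\{c\mid\forall c'.\ c\rightarrow c'\Rightarrow c'\in[\![\varphi]\!]_\varepsilon\}$, and $[\![\mu X.\varphi]\!]_\varepsilon$, $[\![\nu X.\varphi]\!]_\varepsilon$ are the least and greatest fixpoints of $C'\mapsto[\![\varphi]\!]_{\varepsilon[X:=C']}$. -}

module Defs where

open import Level using (Level; _⊔_; 0ℓ) renaming (suc to lsuc)
open import Data.Bool using (Bool; true; false)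
open import Data.Nat as ℕ using (ℕ)
open import Data.Integer as ℤ using (ℤ; +_)
open import Data.Fin using (Fin)
open import Data.Vec using (Vec; map; zipWith; replicate)
open import Data.Vec.Relation.Binary.Pointwise.Inductive using (Pointwise)
open import Data.List using (List)
open import Data.List.Membership.Propositional using (_∈_)
open import Data.Product using (Σ; _×_; _,_; proj₁; proj₂; ∃)
open import Relation.Binary.PropositionalEquality using (_≡_)
open import Relation.Nullary using (yes; no)
open import Relation.Unary using (Pred; _⊆_; _∩_; _∪_; _≐_)

record VASS : Set where
  field
    d : ℕ
    n : ℕ
    T : List (Fin n × Vec ℤ d × Fin n)

module _ (V : VASS) where
  open VASS V

  State : Set
  State = Fin n

  Config : Set
  Config = State × Vec ℕ d

  -- (Q₁ , Q_P)-single-sidedness; the partition Q = Q₁ ⊎ Q_P is given by the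
  -- characteristic function isP of Q_P (Q₁ = states with isP q ≡ false).
  SingleSided : (State → Bool) → Set
  SingleSided isP = ∀ q z q' → (q , z , q') ∈ T → isP q ≡ true → z ≡ replicate d (+ 0)

  Step : Config → Config → Set
  Step (q , v) (q' , v') =
    Σ (Vec ℤ d) λ z → ((q , z , q') ∈ T) × (map +_ v' ≡ zipWith ℤ._+_ (map +_ v) z)

  _≤C_ : Config → Config → Set
  (q , v) ≤C (q' , v') = (q ≡ q') × Pointwise ℕ._≤_ v v'

  UpwardClosed : ∀ {ℓ} → Pred Config ℓ → Set ℓ
  UpwardClosed S = ∀ {c c'} → c ≤C c' → S c → S c'

  data Formula : Set where
    st      : State → Formula
    var     : ℕ → Formula
    _and_   : Formula → Formula → Formula
    _or_    : Formula → Formula → Formula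
    ◇_      : Formula → Formula
    QP∧□_   : Formula → Formula
    μ       : ℕ → Formula → Formula
    ν       : ℕ → Formula → Formula

  Env : (ℓ : Level) → Set (lsuc ℓ)
  Env ℓ = ℕ → Pred Config ℓ

  UpwardClosedEnv : ∀ {ℓ} → Env ℓ → Set ℓ
  UpwardClosedEnv ε = ∀ X → UpwardClosed (ε X)

  update : ∀ {ℓ} → Env ℓ → ℕ → Pred Config ℓ → Env ℓ
  update ε X C Y with X ℕ.≟ Y
  ... | yes _ = C
  ... | no  _ = ε Y

  ⟦st⟧ : State → Pred Config 0ℓ
  ⟦st⟧ q c = proj₁ c ≡ q

  ⟦QP⟧ : (State → Bool) → Pred Config 0ℓ
  ⟦QP⟧ isP c = isP (proj₁ c) ≡ true

  Pre◇ : ∀ {ℓ} → Pred Config ℓ → Pred Config ℓ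
  Pre◇ S c = ∃ λ c' → Step c c' × S c'

  Pre□ : ∀ {ℓ} → Pred Config ℓ → Pred Config ℓ
  Pre□ S c = ∀ c' → Step c c' → S c'

  -- A function sem : Formula → Env ℓ → Pred Config ℓ is *the* semantics
  -- ⟦_⟧ of L^sv_μ (sets of configurations = predicates at level ℓ) iff it
  -- satisfies the defining clauses; fixpoints are least/greatest in the
  -- lattice Pred Config ℓ ordered by ⊆ (Knaster–Tarski). The semantics is
  -- unique up to ≐.
  record IsSemantics (isP : State → Bool) {ℓ : Level}
                     (sem : Formula → Env ℓ → Pred Config ℓ) : Set (lsuc ℓ) where
    field
      sem-st  : ∀ q ε → sem (st q) ε ≐ ⟦st⟧ q
      sem-var : ∀ X ε → sem (var X) ε ≐ ε X
      sem-and : ∀ φ ψ ε → sem (φ and ψ) ε ≐ (sem φ ε ∩ sem ψ ε)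
      sem-or  : ∀ φ ψ ε → sem (φ or ψ) ε ≐ (sem φ ε ∪ sem ψ ε)
      sem-◇   : ∀ φ ε → sem (◇ φ) ε ≐ Pre◇ (sem φ ε)
      sem-□   : ∀ φ ε → sem (QP∧□ φ) ε ≐ (⟦QP⟧ isP ∩ Pre□ (sem φ ε))
      sem-μ-fix   : ∀ X φ ε → sem φ (update ε X (sem (μ X φ) ε)) ≐ sem (μ X φ) ε
      sem-μ-least : ∀ X φ ε (C : Pred Config ℓ) →
                    sem φ (update ε X C) ⊆ C → sem (μ X φ) ε ⊆ C
      sem-ν-fix     : ∀ X φ ε → sem φ (update ε X (sem (ν X φ) ε)) ≐ sem (ν X φ) ε
      sem-ν-greatest : ∀ X φ ε (C : Pred Config ℓ) →
                    C ⊆ sem φ (update ε X C) → C ⊆ sem (ν X φ) ε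

{-# OPTIONS --safe #-}
module Submission where

-- The only guard of a transition is that the counters stay nonnegative, so
-- the steps of a VASS are upward compatible: a step from c can be copied
-- from any c' ≥ c, reaching a configuration above the original target.
-- This makes ◇ preserve upward closure. □ generally does not, but at a state
-- of Q_P every transition has the zero vector, so there the successors of
-- ⟨q,w⟩ are exactly the ⟨q',w⟩ for the successors ⟨q',v⟩ of ⟨q,v⟩. For the
-- fixpoints, μX.φ is contained in the largest upward-closed subset of itself,
-- which is a pre-fixpoint by induction and monotonicity; dually νX.φ contains
-- its upward closure, which is a post-fixpoint.

open import Defs
open import Level using (Level)
open import Data.Bool using (Bool; true)
open import Data.Nat as ℕ using (ℕ; _∸_)
import Data.Nat.Properties as ℕₚ
open import Data.Integer as ℤ using (ℤ; +_)
import Data.Integer.Properties as ℤₚ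
open import Algebra.Properties.CommutativeSemigroup ℤₚ.+-commutativeSemigroup
  using (xy∙z≈xz∙y)
open import Data.Vec using (Vec; []; _∷_; map; zipWith; replicate)
open import Data.Vec.Properties using (∷-injective; zipWith-identityʳ)
open import Data.Vec.Relation.Binary.Pointwise.Inductive as Pointwise
  using (Pointwise; []; _∷_)
open import Data.Product using (∃; _×_; _,_; proj₁; proj₂)
open import Data.Sum using (inj₁; inj₂)
open import Function using (id; _∘′_; _$_)
open import Function.Definitions using (Injective)
open import Relation.Binary.PropositionalEquality
open import Relation.Nullary using (yes; no)
open import Relation.Unary using (Pred; _⊆_; _≐_; _∩_; _∪_)
open import Relation.Unary.Properties using (≐-sym)

counter-lift : ∀ {v v' w : ℕ} {z : ℤ} → v ℕ.≤ w → + v' ≡ + v ℤ.+ z →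
               + (v' ℕ.+ (w ∸ v)) ≡ + w ℤ.+ z
counter-lift {v} {v'} {w} {z} v≤w eq = begin
  + v' ℤ.+ + (w ∸ v)         ≡⟨ cong (ℤ._+ + (w ∸ v)) eq ⟩
  + v ℤ.+ z ℤ.+ + (w ∸ v)    ≡⟨ xy∙z≈xz∙y (+ v) z (+ (w ∸ v)) ⟩
  + (v ℕ.+ (w ∸ v)) ℤ.+ z    ≡⟨ cong (λ u → + u ℤ.+ z) (ℕₚ.m+[n∸m]≡n v≤w) ⟩
  + w ℤ.+ z                  ∎
  where open ≡-Reasoning

counters-lift : ∀ {k} {v v' w : Vec ℕ k} (z : Vec ℤ k) → Pointwise ℕ._≤_ v w →
                map +_ v' ≡ zipWith ℤ._+_ (map +_ v) z →
                ∃ λ w' → map +_ w' ≡ zipWith ℤ._+_ (map +_ w) z × Pointwise ℕ._≤_ v' w'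
counters-lift {v' = []} [] [] _ = [] , refl , []
counters-lift {v = a ∷ _} {a' ∷ _} {b ∷ _} (c ∷ z) (a≤b ∷ v≤w) eq
  with head-eq , tail-eq ← ∷-injective eq
  with w' , w'-eq , v'≤w' ← counters-lift z v≤w tail-eq
  = a' ℕ.+ (b ∸ a) ∷ w'
  , cong₂ _∷_ (counter-lift {z = c} a≤b head-eq) w'-eq
  , ℕₚ.m≤m+n a' (b ∸ a) ∷ v'≤w'

map-injective : ∀ {a b} {A : Set a} {B : Set b} {f : A → B} {k} →
                Injective _≡_ _≡_ f → Injective _≡_ _≡_ (map {n = k} f)
map-injective _ {[]}    {[]}    _  = refl
map-injective f-inj {_ ∷ _} {_ ∷ _} eq with x-eq , xs-eq ← ∷-injective eq =
  cong₂ _∷_ (f-inj x-eq) (map-injective f-inj xs-eq)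

module _ (V : VASS) where
  open VASS V using (d)

  private variable
    ℓ ℓ' : Level
    S C C' : Pred (Config V) ℓ
    S' : Pred (Config V) ℓ'
    ε ε' : Env V ℓ

  ≤C-refl : ∀ {c} → _≤C_ V c c
  ≤C-refl = refl , Pointwise.refl ℕₚ.≤-refl

  ≤C-trans : ∀ {a b c} → _≤C_ V a b → _≤C_ V b c → _≤C_ V a c
  ≤C-trans (refl , v≤w) (refl , w≤u) = refl , Pointwise.trans ℕₚ.≤-trans v≤w w≤u

  Step-upward-compatible : ∀ {c c' e} → _≤C_ V c e → Step V c c' →
                           ∃ λ e' → Step V e e' × _≤C_ V c' e'
  Step-upward-compatible {c' = q' , _} (refl , v≤w) (z , t , eq)
    with w' , w'-eq , v'≤w' ← counters-lift z v≤w eq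
    = (q' , w') , (z , t , w'-eq) , (refl , v'≤w')

  Step-from-QP : ∀ {isP} → SingleSided V isP → ∀ {q q' w w'} → isP q ≡ true →
                 Step V (q , w) (q' , w') → w' ≡ w × (∀ v → Step V (q , v) (q' , v))
  Step-from-QP ss {w = w} p (z , t , eq) with refl ← ss _ z _ t p =
    map-injective ℤₚ.+-injective (trans eq (+0-identityʳ w)) ,
    λ v → _ , t , sym (+0-identityʳ v)
    where
    +0-identityʳ : ∀ (v : Vec ℕ d) → zipWith ℤ._+_ (map +_ v) (replicate d (+ 0)) ≡ map +_ v
    +0-identityʳ v = zipWith-identityʳ ℤₚ.+-identityʳ (map +_ v)

  UpwardClosed-resp-≐ : S ≐ S' → UpwardClosed V S → UpwardClosed V S'
  UpwardClosed-resp-≐ (S⊆S' , S'⊆S) S-uc c≤c' x = S⊆S' (S-uc c≤c' (S'⊆S x))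

  ⟦st⟧-upwardClosed : ∀ q → UpwardClosed V (⟦st⟧ V q)
  ⟦st⟧-upwardClosed q (refl , _) = id

  ∩-upwardClosed : UpwardClosed V S → UpwardClosed V S' → UpwardClosed V (S ∩ S')
  ∩-upwardClosed S-uc S'-uc c≤c' (x , y) = S-uc c≤c' x , S'-uc c≤c' y

  ∪-upwardClosed : UpwardClosed V S → UpwardClosed V S' → UpwardClosed V (S ∪ S')
  ∪-upwardClosed S-uc S'-uc c≤c' (inj₁ x) = inj₁ (S-uc c≤c' x)
  ∪-upwardClosed S-uc S'-uc c≤c' (inj₂ y) = inj₂ (S'-uc c≤c' y)

  Pre◇-upwardClosed : UpwardClosed V S → UpwardClosed V (Pre◇ V S)
  Pre◇-upwardClosed S-uc c≤e (c' , step , x)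
    with e' , step' , c'≤e' ← Step-upward-compatible c≤e step
    = e' , step' , S-uc c'≤e' x

  QP∧Pre□-upwardClosed : ∀ {isP} → SingleSided V isP → UpwardClosed V S →
                         UpwardClosed V (⟦QP⟧ V isP ∩ Pre□ V S)
  QP∧Pre□-upwardClosed {S = S} ss S-uc {q , v} {_ , w} (refl , v≤w) (p , all) = p , all-from-w
    where
    all-from-w : Pre□ V S (q , w)
    all-from-w (_ , _) step with refl , step-at ← Step-from-QP ss p step =
      S-uc (refl , v≤w) (all _ (step-at v))

  ↑-closure : Pred (Config V) ℓ → Pred (Config V) ℓ
  ↑-closure S c = ∃ λ b → _≤C_ V b c × S b

  ↑-interior : Pred (Config V) ℓ → Pred (Config V) ℓ
  ↑-interior S c = ∀ c' → _≤C_ V c c' → S c'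

  ↑-closure-upwardClosed : UpwardClosed V (↑-closure S)
  ↑-closure-upwardClosed c≤c' (b , b≤c , x) = b , ≤C-trans b≤c c≤c' , x

  ↑-interior-upwardClosed : UpwardClosed V (↑-interior S)
  ↑-interior-upwardClosed c≤c' x c'' c'≤c'' = x c'' (≤C-trans c≤c' c'≤c'')

  ⊆-↑-closure : S ⊆ ↑-closure S
  ⊆-↑-closure x = _ , ≤C-refl , x

  ↑-interior-⊆ : ↑-interior S ⊆ S
  ↑-interior-⊆ x = x _ ≤C-refl

  ↑-closure-least : UpwardClosed V S' → S ⊆ S' → ↑-closure S ⊆ S'
  ↑-closure-least S'-uc S⊆S' (b , b≤c , x) = S'-uc b≤c (S⊆S' x)

  ↑-interior-greatest : UpwardClosed V S → S ⊆ S' → S ⊆ ↑-interior S'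
  ↑-interior-greatest S-uc S⊆S' x c' c≤c' = S⊆S' (S-uc c≤c' x)

  ↑-closure⊆⇒upwardClosed : ↑-closure S ⊆ S → UpwardClosed V S
  ↑-closure⊆⇒upwardClosed cl⊆S c≤c' x = cl⊆S (_ , c≤c' , x)

  ⊆↑-interior⇒upwardClosed : S ⊆ ↑-interior S → UpwardClosed V S
  ⊆↑-interior⇒upwardClosed S⊆int c≤c' x = S⊆int x _ c≤c'

  _⊆ᴱ_ : Env V ℓ → Env V ℓ → Set ℓ
  ε ⊆ᴱ ε' = ∀ X → ε X ⊆ ε' X

  ⊆ᴱ-refl : ε ⊆ᴱ ε
  ⊆ᴱ-refl _ = id

  update-mono : ∀ X → ε ⊆ᴱ ε' → C ⊆ C' → update V ε X C ⊆ᴱ update V ε' X C'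
  update-mono X ε⊆ε' C⊆C' Y with X ℕ.≟ Y
  ... | yes _ = C⊆C'
  ... | no  _ = ε⊆ε' Y

  update-upwardClosed : ∀ X → UpwardClosedEnv V ε → UpwardClosed V C →
                        UpwardClosedEnv V (update V ε X C)
  update-upwardClosed X ε-uc C-uc Y with X ℕ.≟ Y
  ... | yes _ = C-uc
  ... | no  _ = ε-uc Y

module _ {ℓ : Level} (V : VASS) {isP : State V → Bool}
         {sem : Formula V → Env V ℓ → Pred (Config V) ℓ} (IS : IsSemantics V isP sem) where
  open IsSemantics IS

  sem-mono : ∀ φ {ε ε' : Env V ℓ} → _⊆ᴱ_ V ε ε' → sem φ ε ⊆ sem φ ε'
  sem-mono (st q) {ε} {ε'} _ = proj₂ (sem-st q ε') ∘′ proj₁ (sem-st q ε)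
  sem-mono (var X) {ε} {ε'} ε⊆ε' = proj₂ (sem-var X ε') ∘′ ε⊆ε' X ∘′ proj₁ (sem-var X ε)
  sem-mono (φ and ψ) {ε} {ε'} ε⊆ε' x with a , b ← proj₁ (sem-and φ ψ ε) x =
    proj₂ (sem-and φ ψ ε') (sem-mono φ ε⊆ε' a , sem-mono ψ ε⊆ε' b)
  sem-mono (φ or ψ) {ε} {ε'} ε⊆ε' x with proj₁ (sem-or φ ψ ε) x
  ... | inj₁ a = proj₂ (sem-or φ ψ ε') (inj₁ (sem-mono φ ε⊆ε' a))
  ... | inj₂ b = proj₂ (sem-or φ ψ ε') (inj₂ (sem-mono ψ ε⊆ε' b))
  sem-mono (◇ φ) {ε} {ε'} ε⊆ε' x with c' , step , y ← proj₁ (sem-◇ φ ε) x =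
    proj₂ (sem-◇ φ ε') (c' , step , sem-mono φ ε⊆ε' y)
  sem-mono (QP∧□ φ) {ε} {ε'} ε⊆ε' x with p , all ← proj₁ (sem-□ φ ε) x =
    proj₂ (sem-□ φ ε') (p , λ c' step → sem-mono φ ε⊆ε' (all c' step))
  sem-mono (μ Y ψ) {ε} {ε'} ε⊆ε' = sem-μ-least Y ψ ε (sem (μ Y ψ) ε') $
    proj₁ (sem-μ-fix Y ψ ε') ∘′ sem-mono ψ (update-mono V Y ε⊆ε' id)
  sem-mono (ν Y ψ) {ε} {ε'} ε⊆ε' = sem-ν-greatest Y ψ ε' (sem (ν Y ψ) ε) $
    sem-mono ψ (update-mono V Y ε⊆ε' id) ∘′ proj₂ (sem-ν-fix Y ψ ε)

  module _ (Y : ℕ) (ψ : Formula V) (ε : Env V ℓ)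
           (ψ-upwardClosed : ∀ C → UpwardClosed V C → UpwardClosed V (sem ψ (update V ε Y C)))
           where

    μ-upwardClosed : UpwardClosed V (sem (μ Y ψ) ε)
    μ-upwardClosed = ⊆↑-interior⇒upwardClosed V (sem-μ-least Y ψ ε I ψ[I]⊆I)
      where
      I : Pred (Config V) ℓ
      I = ↑-interior V (sem (μ Y ψ) ε)
      ψ[I]⊆I : sem ψ (update V ε Y I) ⊆ I
      ψ[I]⊆I = ↑-interior-greatest V (ψ-upwardClosed I (↑-interior-upwardClosed V)) $
        proj₁ (sem-μ-fix Y ψ ε) ∘′ sem-mono ψ (update-mono V Y (⊆ᴱ-refl V) (↑-interior-⊆ V))

    ν-upwardClosed : UpwardClosed V (sem (ν Y ψ) ε)
    ν-upwardClosed = ↑-closure⊆⇒upwardClosed V (sem-ν-greatest Y ψ ε U U⊆ψ[U])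
      where
      U : Pred (Config V) ℓ
      U = ↑-closure V (sem (ν Y ψ) ε)
      U⊆ψ[U] : U ⊆ sem ψ (update V ε Y U)
      U⊆ψ[U] = ↑-closure-least V (ψ-upwardClosed U (↑-closure-upwardClosed V)) $
        sem-mono ψ (update-mono V Y (⊆ᴱ-refl V) (⊆-↑-closure V)) ∘′ proj₂ (sem-ν-fix Y ψ ε)

lemma11 : ∀ {ℓ : Level} (V : VASS) (isP : State V → Bool) → SingleSided V isP →
    (sem : Formula V → Env V ℓ → Pred (Config V) ℓ) → IsSemantics V isP sem →
    ∀ (φ : Formula V) (ε : Env V ℓ) → UpwardClosedEnv V ε → UpwardClosed V (sem φ ε)
lemma11 V isP ss sem IS = upwardClosed
  where
  open IsSemantics IS

  via-≐ : ∀ {φ ε ℓ'} {S : Pred (Config V) ℓ'} → sem φ ε ≐ S →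
          UpwardClosed V S → UpwardClosed V (sem φ ε)
  via-≐ eq = UpwardClosed-resp-≐ V (≐-sym eq)

  upwardClosed : ∀ φ ε → UpwardClosedEnv V ε → UpwardClosed V (sem φ ε)
  upwardClosed (st q) ε _ = via-≐ (sem-st q ε) (⟦st⟧-upwardClosed V q)
  upwardClosed (var X) ε ε-uc = via-≐ (sem-var X ε) (ε-uc X)
  upwardClosed (φ and ψ) ε ε-uc =
    via-≐ (sem-and φ ψ ε) (∩-upwardClosed V (upwardClosed φ ε ε-uc) (upwardClosed ψ ε ε-uc))
  upwardClosed (φ or ψ) ε ε-uc =
    via-≐ (sem-or φ ψ ε) (∪-upwardClosed V (upwardClosed φ ε ε-uc) (upwardClosed ψ ε ε-uc))
  upwardClosed (◇ φ) ε ε-uc = via-≐ (sem-◇ φ ε) (Pre◇-upwardClosed V (upwardClosed φ ε ε-uc))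
  upwardClosed (QP∧□ φ) ε ε-uc =
    via-≐ (sem-□ φ ε) (QP∧Pre□-upwardClosed V ss (upwardClosed φ ε ε-uc))
  upwardClosed (μ Y ψ) ε ε-uc = μ-upwardClosed V IS Y ψ ε λ C C-uc →
    upwardClosed ψ (update V ε Y C) (update-upwardClosed V Y ε-uc C-uc)
  upwardClosed (ν Y ψ) ε ε-uc = ν-upwardClosed V IS Y ψ ε λ C C-uc →
    upwardClosed ψ (update V ε Y C) (update-upwardClosed V Y ε-uc C-uc)
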